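{- Let $f$ be a positive integer and $D$ a square-free positive integer, and let $\theta=f\cdot i\sqrt{D}$ if $D\not\equiv 3\pmod 4$, and $\theta=f\cdot\frac{1+i\sqrt{D}}{2}$ if $D\equiv 3\pmod 4$. Let $a$ be an odd integer. Then there exist $m,r,s\in\mathbb{Z}$ such that $m-\theta=(a+4\theta)(r+s\theta)$. -}

module Defs where

open import Data.Nat as ℕ using (ℕ; _%_)
open import Data.Nat.Divisibility as ℕD using ()
open import Data.Nat.Primality using (Prime)
open import Data.Integer as ℤ using (ℤ; +_)
open import Data.Rational as ℚ using (ℚ; _/_; ½)
open import Relation.Nullary using (¬_)
open import Relation.Binary.PropositionalEquality using (_≡_)
open import Data.Product using (_×_)

SquareFree : ℕ → Set
SquareFree D = ∀ p → Prime p → ¬ (p ℕ.* p ℕD.∣ D)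

-- Elements of the field ℚ(i√D) ⊂ ℂ, written  re + im · i√D  with re, im ∈ ℚ.
-- Since √D > 0 is real, two such complex numbers are equal iff both
-- coordinates agree.
record QiD : Set where
  constructor _+_·i√D
  field
    re : ℚ
    im : ℚ
open QiD public

module _ (D : ℕ) where
  private Dq = (+ D) / 1

  add : QiD → QiD → QiD
  add (a + b ·i√D) (c + d ·i√D) = (a ℚ.+ c) + (b ℚ.+ d) ·i√D

  sub : QiD → QiD → QiD
  sub (a + b ·i√D) (c + d ·i√D) = (a ℚ.- c) + (b ℚ.- d) ·i√D

  mul : QiD → QiD → QiD
  mul (a + b ·i√D) (c + d ·i√D) =
    (a ℚ.* c ℚ.- Dq ℚ.* (b ℚ.* d)) + (a ℚ.* d ℚ.+ b ℚ.* c) ·i√D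

_≋_ : QiD → QiD → Set
x ≋ y = (re x ≡ re y) × (im x ≡ im y)

int : ℤ → QiD
int z = ((z / 1) + ((+ 0) / 1) ·i√D)

scale : ℤ → QiD → QiD
scale z (a + b ·i√D) = ((z / 1) ℚ.* a) + ((z / 1) ℚ.* b) ·i√D

θ : (f D : ℕ) → QiD
θ f D with D % 4
... | 3 = ((+ f) / 1 ℚ.* ½) + ((+ f) / 1 ℚ.* ½) ·i√D
... | _ = ((+ 0) / 1) + ((+ f) / 1) ·i√D

-- Everything rests on θ being an algebraic integer of degree two: if θ² = tθ − n with
-- t, n ∈ ℤ, then (a + bθ)(r + sθ) = (ar − bsn) + (as + br + bst)θ. For odd a = 1 + 2k take
-- s = −a and r = k(k + 1) + at; the θ-coefficient of (a + 4θ)(r + sθ) is then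
-- −a² + 4k(k + 1) = −1, so the product is m − θ with m = ar + 4an. Both shapes of θ are such
-- roots (t = 0, n = f²D, resp. t = f, n = f²(D + 1)/4).
module Submission where

open import Defs
open import Data.Nat using (ℕ; NonZero)
open import Data.Integer using (ℤ; +_)
open import Data.Integer.Divisibility using (_∣_)
open import Data.Product using (∃-syntax)
open import Relation.Nullary using (¬_)

import Data.Nat as ℕ
import Data.Nat.DivMod as ℕ
import Data.Integer as ℤ
import Data.Integer.Properties as ℤP
open import Data.Integer.DivMod using (_%ℕ_; _/ℕ_; a≡a%ℕn+[a/ℕn]*n; n%ℕd<d)
open import Data.Integer.Divisibility.Signed using (divides; ∣⇒∣ᵤ)
open import Data.Integer.Tactic.RingSolver using () renaming (ring to ℤ-ring)
open import Data.Rational as ℚ using (ℚ; _/_; ½; toℚᵘ)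
import Data.Rational.Properties as ℚP
open import Data.Rational.Unnormalised as ℚᵘ using (mkℚᵘ; *≡*) renaming (_≃_ to _≃ᵘ_)
import Data.Rational.Unnormalised.Properties as ℚᵘ
open import Data.Product using (_,_)
open import Level using (0ℓ)
open import Relation.Binary.PropositionalEquality
open import Relation.Nullary using (contradiction)
open import Relation.Nullary.Decidable using (dec⇒maybe)
open import Tactic.RingSolver using (solve-∀)
open import Tactic.RingSolver.Core.AlmostCommutativeRing
  using (AlmostCommutativeRing; fromCommutativeRing)

ℚ-ring : AlmostCommutativeRing 0ℓ 0ℓ
ℚ-ring = fromCommutativeRing ℚP.+-*-commutativeRing (λ x → dec⇒maybe (ℚ.0ℚ ℚP.≟ x))

ι : ℤ → ℚ
ι z = z / 1

toℚᵘ-ι : ∀ z → toℚᵘ (ι z) ≃ᵘ mkℚᵘ z 0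
toℚᵘ-ι z = ℚP.toℚᵘ-fromℚᵘ (mkℚᵘ z 0)

ι-+ : ∀ x y → ι (x ℤ.+ y) ≡ ι x ℚ.+ ι y
ι-+ x y = ℚP.toℚᵘ-injective (begin
  toℚᵘ (ι (x ℤ.+ y))           ≈⟨ toℚᵘ-ι (x ℤ.+ y) ⟩
  mkℚᵘ (x ℤ.+ y) 0             ≈⟨ *≡* (cong (ℤ._* + 1) (sym (cong₂ ℤ._+_ (ℤP.*-identityʳ x)
                                                                     (ℤP.*-identityʳ y)))) ⟩
  mkℚᵘ x 0 ℚᵘ.+ mkℚᵘ y 0       ≈⟨ ℚᵘ.+-cong (toℚᵘ-ι x) (toℚᵘ-ι y) ⟨
  toℚᵘ (ι x) ℚᵘ.+ toℚᵘ (ι y)   ≈⟨ ℚP.toℚᵘ-homo-+ (ι x) (ι y) ⟨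
  toℚᵘ (ι x ℚ.+ ι y)           ∎)
  where open ℚᵘ.≃-Reasoning

ι-* : ∀ x y → ι (x ℤ.* y) ≡ ι x ℚ.* ι y
ι-* x y = ℚP.toℚᵘ-injective (begin
  toℚᵘ (ι (x ℤ.* y))           ≈⟨ toℚᵘ-ι (x ℤ.* y) ⟩
  mkℚᵘ x 0 ℚᵘ.* mkℚᵘ y 0       ≈⟨ ℚᵘ.*-cong (toℚᵘ-ι x) (toℚᵘ-ι y) ⟨
  toℚᵘ (ι x) ℚᵘ.* toℚᵘ (ι y)   ≈⟨ ℚP.toℚᵘ-homo-* (ι x) (ι y) ⟨
  toℚᵘ (ι x ℚ.* ι y)           ∎)
  where open ℚᵘ.≃-Reasoning

ι-neg : ∀ x → ι (ℤ.- x) ≡ ℚ.- ι x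
ι-neg x = ℚP.toℚᵘ-injective (begin
  toℚᵘ (ι (ℤ.- x))             ≈⟨ toℚᵘ-ι (ℤ.- x) ⟩
  ℚᵘ.- mkℚᵘ x 0                ≈⟨ ℚᵘ.-‿cong (toℚᵘ-ι x) ⟨
  ℚᵘ.- toℚᵘ (ι x)              ≈⟨ ℚP.toℚᵘ-homo‿- (ι x) ⟨
  toℚᵘ (ℚ.- ι x)               ∎)
  where open ℚᵘ.≃-Reasoning

≋-sym : ∀ {x y} → x ≋ y → y ≋ x
≋-sym (re≡ , im≡) = sym re≡ , sym im≡

≋-trans : ∀ {x y z} → x ≋ y → y ≋ z → x ≋ z
≋-trans (re₁ , im₁) (re₂ , im₂) = trans re₁ re₂ , trans im₁ im₂

sub-int≋add-scale-neg : ∀ D m θ → sub D (int m) θ ≋ add D (int m) (scale (ℤ.- + 1) θ)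
sub-int≋add-scale-neg D m θ = x-y≡x+[-1]y (ι m) (re θ) , x-y≡x+[-1]y (ι (+ 0)) (im θ)
  where
  open import Data.Rational using (_+_; _*_; _-_)
  x-y≡x+[-1]y : ∀ x y → x - y ≡ x + ι (ℤ.- + 1) * y
  x-y≡x+[-1]y = solve-∀ ℚ-ring

record QuadraticRoot (D : ℕ) (t n : ℤ) (θ : QiD) : Set where
  constructor quadraticRoot
  field
    θ²≋tθ-n : mul D θ θ ≋ sub D (scale t θ) (int n)

module _ where
  open import Data.Rational using (0ℚ; _+_; _*_; _-_)

  expand-re : ∀ Δ A B R S u v →
    (A + B * u) * (R + S * u) - Δ * ((0ℚ + B * v) * (0ℚ + S * v))
      ≡ A * R + (A * S + B * R) * u + B * S * (u * u - Δ * (v * v))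
  expand-re = solve-∀ ℚ-ring

  collect-re : ∀ A B R S T N u →
    A * R + (A * S + B * R) * u + B * S * (T * u - N)
      ≡ (A * R - B * S * N) + (A * S + B * R + B * S * T) * u
  collect-re = solve-∀ ℚ-ring

  expand-im : ∀ A B R S u v →
    (A + B * u) * (0ℚ + S * v) + (0ℚ + B * v) * (R + S * u)
      ≡ (A * S + B * R) * v + B * S * (u * v + v * u)
  expand-im = solve-∀ ℚ-ring

  collect-im : ∀ A B R S T v →
    (A * S + B * R) * v + B * S * (T * v - 0ℚ) ≡ 0ℚ + (A * S + B * R + B * S * T) * v
  collect-im = solve-∀ ℚ-ring

  mul-ℤ[θ] : ∀ {D t n θ} → QuadraticRoot D t n θ → ∀ a b r s →
    mul D (add D (int a) (scale b θ)) (add D (int r) (scale s θ))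
      ≋ add D (int (a ℤ.* r ℤ.- b ℤ.* s ℤ.* n)) (scale (a ℤ.* s ℤ.+ b ℤ.* r ℤ.+ b ℤ.* s ℤ.* t) θ)
  mul-ℤ[θ] {D} {t} {n} {θ} (quadraticRoot (θ²≡tθ-n-re , θ²≡tθ-n-im)) a b r s =
      (begin
        (A + B * u) * (R + S * u) - ι (+ D) * ((0ℚ + B * v) * (0ℚ + S * v))
          ≡⟨ expand-re (ι (+ D)) A B R S u v ⟩
        A * R + (A * S + B * R) * u + B * S * (u * u - ι (+ D) * (v * v))
          ≡⟨ cong (λ w → A * R + (A * S + B * R) * u + B * S * w) θ²≡tθ-n-re ⟩
        A * R + (A * S + B * R) * u + B * S * (ι t * u - ι n)
          ≡⟨ collect-re A B R S (ι t) (ι n) u ⟩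
        (A * R - B * S * ι n) + (A * S + B * R + B * S * ι t) * u
          ≡⟨ cong₂ (λ c d → c + d * u) ι-constant ι-coefficient ⟨
        ι (a ℤ.* r ℤ.- b ℤ.* s ℤ.* n) + ι (a ℤ.* s ℤ.+ b ℤ.* r ℤ.+ b ℤ.* s ℤ.* t) * u ∎)
    , (begin
        (A + B * u) * (0ℚ + S * v) + (0ℚ + B * v) * (R + S * u)
          ≡⟨ expand-im A B R S u v ⟩
        (A * S + B * R) * v + B * S * (u * v + v * u)
          ≡⟨ cong (λ w → (A * S + B * R) * v + B * S * w) θ²≡tθ-n-im ⟩
        (A * S + B * R) * v + B * S * (ι t * v - 0ℚ)
          ≡⟨ collect-im A B R S (ι t) v ⟩
        0ℚ + (A * S + B * R + B * S * ι t) * v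
          ≡⟨ cong (λ d → 0ℚ + d * v) ι-coefficient ⟨
        0ℚ + ι (a ℤ.* s ℤ.+ b ℤ.* r ℤ.+ b ℤ.* s ℤ.* t) * v ∎)
    where
    open ≡-Reasoning
    A B R S u v : ℚ
    A = ι a
    B = ι b
    R = ι r
    S = ι s
    u = re θ
    v = im θ

    ι-constant : ι (a ℤ.* r ℤ.- b ℤ.* s ℤ.* n) ≡ A * R - B * S * ι n
    ι-constant = trans (ι-+ (a ℤ.* r) (ℤ.- (b ℤ.* s ℤ.* n)))
      (cong₂ _+_ (ι-* a r)
                 (trans (ι-neg (b ℤ.* s ℤ.* n))
                        (cong ℚ.-_ (trans (ι-* (b ℤ.* s) n) (cong (_* ι n) (ι-* b s))))))

    ι-coefficient : ι (a ℤ.* s ℤ.+ b ℤ.* r ℤ.+ b ℤ.* s ℤ.* t) ≡ A * S + B * R + B * S * ι t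
    ι-coefficient = trans (ι-+ (a ℤ.* s ℤ.+ b ℤ.* r) (b ℤ.* s ℤ.* t))
      (cong₂ _+_ (trans (ι-+ (a ℤ.* s) (b ℤ.* r)) (cong₂ _+_ (ι-* a s) (ι-* b r)))
                 (trans (ι-* (b ℤ.* s) t) (cong (_* ι t) (ι-* b s))))

odd⇒≡1+k*2 : ∀ a → ¬ (+ 2 ∣ a) → ∃[ k ] a ≡ + 1 ℤ.+ k ℤ.* + 2
odd⇒≡1+k*2 a 2∤a with a %ℕ 2 | a≡a%ℕn+[a/ℕn]*n a 2 | n%ℕd<d a 2
... | 0 | a≡0+q*2 | _ =
  contradiction (∣⇒∣ᵤ (divides (a /ℕ 2) (trans a≡0+q*2 (ℤP.+-identityˡ (a /ℕ 2 ℤ.* + 2))))) 2∤a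
... | 1 | a≡1+q*2 | _ = a /ℕ 2 , a≡1+q*2
... | ℕ.suc (ℕ.suc _) | _ | ℕ.s≤s (ℕ.s≤s ())

a+4θ∣m-θ : ∀ {D t n θ} → QuadraticRoot D t n θ → ∀ a → ¬ (+ 2 ∣ a) →
  ∃[ m ] ∃[ r ] ∃[ s ]
    (sub D (int m) θ ≋ mul D (add D (int a) (scale (+ 4) θ)) (add D (int r) (scale s θ)))
a+4θ∣m-θ {D} {t} {n} {θ} root a 2∤a with odd⇒≡1+k*2 a 2∤a
... | k , refl = m , r , s , ≋-trans (sub-int≋add-scale-neg D m θ) (≋-sym product)
  where
  s r m : ℤ
  s = ℤ.- a
  r = k ℤ.* (k ℤ.+ + 1) ℤ.+ a ℤ.* t
  m = a ℤ.* r ℤ.- + 4 ℤ.* s ℤ.* n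

  θ-coefficient : ∀ k t → let a = + 1 ℤ.+ k ℤ.* + 2 in
    a ℤ.* ℤ.- a ℤ.+ + 4 ℤ.* (k ℤ.* (k ℤ.+ + 1) ℤ.+ a ℤ.* t) ℤ.+ + 4 ℤ.* ℤ.- a ℤ.* t ≡ ℤ.- + 1
  θ-coefficient = solve-∀ ℤ-ring

  [a+4θ][r+sθ] : QiD
  [a+4θ][r+sθ] = mul D (add D (int a) (scale (+ 4) θ)) (add D (int r) (scale s θ))

  product : [a+4θ][r+sθ] ≋ add D (int m) (scale (ℤ.- + 1) θ)
  product = subst (λ c → [a+4θ][r+sθ] ≋ add D (int m) (scale c θ))
                  (θ-coefficient k t) (mul-ℤ[θ] root a (+ 4) r s)

F·i√D-root : ∀ D F → QuadraticRoot D (+ 0) (F ℤ.* F ℤ.* + D) (ι (+ 0) + ι F ·i√D)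
F·i√D-root D F = quadraticRoot
  ( trans (re-identity (ι F) (ι (+ D))) (cong (λ x → 0ℚ * 0ℚ - x) (sym ι-norm))
  , im-identity (ι F))
  where
  open import Data.Rational using (0ℚ; _+_; _*_; _-_)
  ι-norm : ι (F ℤ.* F ℤ.* + D) ≡ ι F * ι F * ι (+ D)
  ι-norm = trans (ι-* (F ℤ.* F) (+ D)) (cong (_* ι (+ D)) (ι-* F F))
  re-identity : ∀ F Δ → 0ℚ * 0ℚ - Δ * (F * F) ≡ 0ℚ * 0ℚ - F * F * Δ
  re-identity = solve-∀ ℚ-ring
  im-identity : ∀ F → 0ℚ * F + F * 0ℚ ≡ 0ℚ * F - 0ℚ
  im-identity = solve-∀ ℚ-ring

F·[1+i√D]/2-root : ∀ {D q} F → D ≡ 3 ℕ.+ q ℕ.* 4 → let H = ι F ℚ.* ½ in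
  QuadraticRoot D F (F ℤ.* F ℤ.* (+ q ℤ.+ + 1)) (H + H ·i√D)
F·[1+i√D]/2-root {D} {q} F D≡3+q*4 = quadraticRoot
  ( trans (cong (λ Δ → H * H - Δ * (H * H)) ι-D)
          (trans (re-identity (ι F) (ι (+ q))) (cong (ι F * H -_) (sym ι-norm)))
  , im-identity (ι F))
  where
  open import Data.Rational using (0ℚ; _+_; _*_; _-_)
  open ≡-Reasoning
  H : ℚ
  H = ι F * ½

  ι-D : ι (+ D) ≡ ι (+ 3) + ι (+ q) * ι (+ 4)
  ι-D = begin
    ι (+ D)                     ≡⟨ cong (λ d → ι (+ d)) D≡3+q*4 ⟩
    ι (+ 3 ℤ.+ + (q ℕ.* 4))     ≡⟨ ι-+ (+ 3) (+ (q ℕ.* 4)) ⟩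
    ι (+ 3) + ι (+ (q ℕ.* 4))   ≡⟨ cong (λ x → ι (+ 3) + ι x) (ℤP.pos-* q 4) ⟩
    ι (+ 3) + ι (+ q ℤ.* + 4)   ≡⟨ cong (λ x → ι (+ 3) + x) (ι-* (+ q) (+ 4)) ⟩
    ι (+ 3) + ι (+ q) * ι (+ 4) ∎

  ι-norm : ι (F ℤ.* F ℤ.* (+ q ℤ.+ + 1)) ≡ ι F * ι F * (ι (+ q) + ι (+ 1))
  ι-norm = trans (ι-* (F ℤ.* F) (+ q ℤ.+ + 1)) (cong₂ _*_ (ι-* F F) (ι-+ (+ q) (+ 1)))

  re-identity : ∀ F Q → let H = F * ½ in
    H * H - (ι (+ 3) + Q * ι (+ 4)) * (H * H) ≡ F * H - F * F * (Q + ι (+ 1))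
  re-identity = solve-∀ ℚ-ring

  im-identity : ∀ F → let H = F * ½ in H * H + H * H ≡ F * H - 0ℚ
  im-identity = solve-∀ ℚ-ring

θ-root : ∀ f D → ∃[ t ] ∃[ n ] QuadraticRoot D t n (θ f D)
-- θ f D computes only once D % 4 is a numeral, hence the separate clauses.
θ-root f D with D ℕ.% 4 in D%4≡r
... | 0 = + 0 , _ , F·i√D-root D (+ f)
... | 1 = + 0 , _ , F·i√D-root D (+ f)
... | 2 = + 0 , _ , F·i√D-root D (+ f)
... | ℕ.suc (ℕ.suc (ℕ.suc (ℕ.suc _))) = + 0 , _ , F·i√D-root D (+ f)
... | 3 = + f , _ , F·[1+i√D]/2-root {q = D ℕ./ 4} (+ f) D≡3+q*4
  where
  D≡3+q*4 : D ≡ 3 ℕ.+ D ℕ./ 4 ℕ.* 4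
  D≡3+q*4 = trans (ℕ.m≡m%n+[m/n]*n D 4) (cong (ℕ._+ D ℕ./ 4 ℕ.* 4) D%4≡r)

lemma2p1 : (f D : ℕ) → NonZero f → NonZero D → SquareFree D →
           (a : ℤ) → ¬ ((+ 2) ∣ a) →
           ∃[ m ] ∃[ r ] ∃[ s ]
             (sub D (int m) (θ f D)
               ≋ mul D (add D (int a) (scale (+ 4) (θ f D))) (add D (int r) (scale s (θ f D))))
lemma2p1 f D _ _ _ a 2∤a with θ-root f D
... | t , n , root = a+4θ∣m-θ root a 2∤a
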